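{- Let $n_1,\dots,n_t$ be nonnegative integers and let $K_{n_1\times 1,n_2\times 2,\dots,n_t\times t}$ denote the complete $(n_1+\dots+n_t)$-partite graph having exactly $n_i$ parts of size $i$ for each $1\le i\le t$ (assumed connected). Then for every $1\le i\le t$, $\binom{IDI(K_{n_1\times 1,\dots,n_t\times t})}{i}\ge n_i$.
   Context: For a connected graph $G=(V,E)$ of diameter $d$ and $f:V\to\mathbb{R}$, the string of $v$ under $f$ is the $d$-vector whose $i$-th coordinate is $\sum_{w:\ d(v,w)=i} f(w)$ ($d(\cdot,\cdot)$ = graph distance). $IDI(G)$ is the minimum $k$ such that some $f$ with $|f(V)|=k$ gives all vertices pairwise distinct strings.
   Formalization: The functions f in the definition of $IDI(G)$ take values in the rationals instead of the reals, both for the attaining function and in the minimality condition. -}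

module Defs where

open import Data.Bool using (Bool; true; false; _∧_; _∨_; not; if_then_else_)
open import Data.Nat using (ℕ; zero; suc; _≤_; _⊔_)
open import Data.Nat.Combinatorics using (_C_)
open import Data.Fin using (Fin; toℕ)
open import Data.Fin.Properties using () renaming (_≟_ to _≟ᶠ_)
import Data.Nat as ℕ
open import Data.List as List using (List; []; _∷_; allFin; concat; concatMap; foldr; length; deduplicate)
open import Data.Bool.ListAction using (any)
open import Data.Nat.ListAction using (sum)
open import Data.Vec as Vec using (Vec; lookup; tabulate; _++_)
open import Data.Rational using (ℚ; 0ℚ; _+_) renaming (_≟_ to _≟ℚ_)
open import Data.Product using (Σ; _×_)
open import Relation.Nullary using (¬_)
open import Relation.Nullary.Decidable using (⌊_⌋)
open import Relation.Binary.PropositionalEquality using (_≡_; _≢_)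

record Graph : Set where
  field
    N   : ℕ
    adj : Fin N → Fin N → Bool
open Graph public

module _ (G : Graph) where
  private
    V = Fin (N G)
    vs : List V
    vs = allFin (N G)

  within : ℕ → V → V → Bool
  within zero    v w = ⌊ v ≟ᶠ w ⌋
  within (suc m) v w = within m v w ∨ any (λ u → within m v u ∧ adj G u w) vs

  Connected : Set
  Connected = ∀ v w → within (N G) v w ≡ true

  -- Graph distance d(v,w): the least i with a walk of length ≤ i from v to w
  -- (searched for i ≤ N, which suffices for connected graphs).
  dist : V → V → ℕ
  dist v w = search (N G) 0
    where
    search : ℕ → ℕ → ℕ
    search zero       i = i
    search (suc fuel) i = if within i v w then i else search fuel (suc i)

  diameter : ℕ
  diameter = foldr _⊔_ 0 (concatMap (λ v → List.map (dist v) vs) vs)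

  -- The string of v under f: the d-vector whose i-th coordinate (i = 1..d)
  -- is the sum of f(w) over the vertices w with d(v,w) = i.
  string : (V → ℚ) → V → Vec ℚ diameter
  string f v = tabulate λ (j : Fin diameter) →
    foldr (λ w s → (if ⌊ dist v w ℕ.≟ suc (toℕ j) ⌋ then f w else 0ℚ) + s) 0ℚ vs

  Distinguishing : (V → ℚ) → Set
  Distinguishing f = ∀ v w → v ≢ w → string f v ≢ string f w

  imageSize : (V → ℚ) → ℕ
  imageSize f = length (deduplicate _≟ℚ_ (List.map f vs))

  IsIDI : ℕ → Set
  IsIDI k = Σ (V → ℚ) (λ f → Distinguishing f × imageSize f ≡ k)
          × (∀ f → Distinguishing f → k ≤ imageSize f)

-- Complete multipartite graph with given list of part sizes.
-- Vertex labels: the vertices of the p-th part (counting from start) get label p.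
partLabels : (L : List ℕ) → ℕ → Vec ℕ (sum L)
partLabels []      p = Vec.[]
partLabels (s ∷ L) p = Vec.replicate s p ++ partLabels L (suc p)

completeMultipartite : List ℕ → Graph
completeMultipartite L = record
  { N   = sum L
  ; adj = λ u w → not ⌊ lookup labels u ℕ.≟ lookup labels w ⌋ }
  where labels = partLabels L 0

-- K_{n_1×1, …, n_t×t}: ns is the vector (n_1,…,n_t); entry j : Fin t is n_{j+1},
-- the number of parts of size j+1.
partSizes : {t : ℕ} → Vec ℕ t → List ℕ
partSizes {t} ns = concat (Vec.toList (tabulate λ (j : Fin t) →
                     List.replicate (lookup ns j) (suc (toℕ j))))

K : {t : ℕ} → Vec ℕ t → Graph
K ns = completeMultipartite (partSizes ns)

{-# OPTIONS --safe #-}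
module Submission where

-- In a connected complete multipartite graph two distinct vertices are at distance 1 when
-- they lie in different parts and at distance 2 when they share a part.  Hence the string
-- of v under f is (S − F(P), F(P) − f(v), 0, …, 0), where P is the part of v, F(P) the sum
-- of f over P and S the sum of f over all vertices; so v is determined by (f(v), F(P)).
-- A distinguishing f is therefore injective on every part, and two parts of the same size
-- cannot carry the same set of values (equal value sets give equal sums F, and then two
-- vertices with equal value get equal strings).  Thus the parts of size i are sent
-- injectively to i-element subsets of the image of f, of which there are IDI C i.

open import Algebra.Bundles using (CommutativeMonoid)
import Algebra.Properties.CommutativeSemigroup as CommutativeSemigroupProperties
open import Data.Bool using (T; true; false; if_then_else_)
open import Data.Bool.Properties using (T-∨; T-∧; T-≡)
open import Data.Empty using (⊥-elim)
open import Data.Fin using (Fin; zero; suc; toℕ)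
open import Data.Fin.Properties using (_≟_; toℕ-injective; suc-injective)
open import Data.List as List
  using (List; []; _∷_; [_]; _++_; foldr; map; filter; length; concat; tabulate; replicate; allFin; deduplicate)
open import Data.List.Properties
  using (foldr-cong; foldr-map; map-tabulate; tabulate-cong; tabulate-lookup; length-++; length-map;
         length-replicate; filter-++; filter-all; filter-none)
open import Data.List.Membership.Propositional using (_∈_)
open import Data.List.Membership.Propositional.Properties
  using (∈-map⁺; ∈-map⁻; ∈-++⁺ˡ; ∈-++⁺ʳ; ∈-∃++; ∈-filter⁺; ∈-filter⁻; ∈-allFin; ∈-deduplicate⁺)
open import Data.List.Membership.Propositional.Properties.WithK using (unique∧set⇒bag)
open import Data.List.Relation.Binary.BagAndSetEquality using (∼bag⇒↭)
open import Data.List.Relation.Binary.Permutation.Propositional using (_↭_; ↭-sym; ↭-trans; ↭⇒↭ₛ)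
open import Data.List.Relation.Binary.Permutation.Propositional.Properties using (shift; ∈-resp-↭; ↭-length)
open import Data.List.Relation.Binary.Subset.Propositional using (_⊆_)
open import Data.List.Relation.Binary.Sublist.Propositional as Sublist using (_∷_; _∷ʳ_)
import Data.List.Relation.Binary.Sublist.Propositional.Properties as Sublistₚ
open import Data.List.Relation.Unary.All as All using (All)
import Data.List.Relation.Unary.All.Properties as Allₚ
open import Data.List.Relation.Unary.AllPairs using ([]; _∷_)
open import Data.List.Relation.Unary.Any as Any using (here; there)
open import Data.List.Relation.Unary.Any.Properties using (any⁺; any⁻; tabulate⁺)
open import Data.List.Relation.Unary.Unique.Propositional using (Unique)
import Data.List.Relation.Unary.Unique.Propositional.Properties as Unique
open import Data.List.Relation.Unary.Unique.DecPropositional.Properties using (deduplicate-!)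
open import Data.Nat using (ℕ; zero; suc; _≤_; z≤n; s≤s) renaming (_+_ to _+ℕ_; _≟_ to _≟ℕ_)
open import Data.Nat.Combinatorics using (_C_; nCk+nC[k+1]≡[n+1]C[k+1])
open import Data.Nat.ListAction using (sum)
open import Data.Nat.Properties using (+-identityʳ; +-suc; module ≤-Reasoning)
import Data.Nat.Properties as ℕ
open import Data.Product as Product using (∃; _×_; _,_; proj₂)
open import Data.Rational using (ℚ; 0ℚ; _+_) renaming (_≟_ to _≟ℚ_)
import Data.Rational.Properties as ℚ
open import Data.Sum using (_⊎_; inj₁; inj₂)
open import Data.Vec as Vec using (Vec; lookup)
import Data.Vec.Properties as Vecₚ
open import Function using (_∘_; id)
open import Function.Bundles using (Equivalence; mk⇔)
open import Level using (0ℓ)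
open import Relation.Binary.Definitions using (DecidableEquality)
open import Relation.Binary.PropositionalEquality
  using (_≡_; _≢_; refl; sym; trans; cong; cong₂; subst; module ≡-Reasoning)
import Relation.Binary.PropositionalEquality as ≡
open import Relation.Nullary using (¬_; yes; no)
open import Relation.Nullary.Decidable
  using (⌊_⌋; ⌊⌋-map′; toWitness; fromWitness; toWitnessFalse; fromWitnessFalse; decidable-stable)
open import Relation.Unary using (Pred; Decidable)

open import Algebra.Properties.Group ℚ.+-0-group using () renaming (∙-cancelʳ to +-cancelʳ)
open import Data.List.Relation.Binary.Permutation.Setoid.Properties (≡.setoid ℚ) using (foldr-commMonoid)
open import Defs

open Equivalence

module _ {A : Set} where

  open ≡-Reasoning

  sumOver : (A → ℚ) → List A → ℚ
  sumOver g = foldr (λ x s → g x + s) 0ℚ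

  sumOver-cong : ∀ {g h : A → ℚ} → (∀ x → g x ≡ h x) → ∀ xs → sumOver g xs ≡ sumOver h xs
  sumOver-cong g≗h = foldr-cong (λ x s → cong (_+ s) (g≗h x)) refl

  sumOver-+ : ∀ (g h : A → ℚ) xs → sumOver (λ x → g x + h x) xs ≡ sumOver g xs + sumOver h xs
  sumOver-+ g h []       = sym (ℚ.+-identityʳ 0ℚ)
  sumOver-+ g h (x ∷ xs) = begin
    (g x + h x) + sumOver (λ x → g x + h x) xs   ≡⟨ cong ((g x + h x) +_) (sumOver-+ g h xs) ⟩
    (g x + h x) + (sumOver g xs + sumOver h xs)  ≡⟨ interchange (g x) (h x) _ _ ⟩
    (g x + sumOver g xs) + (h x + sumOver h xs)  ∎
    where open CommutativeSemigroupProperties (CommutativeMonoid.commutativeSemigroup ℚ.+-0-commutativeMonoid)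

  sumOver-zero : ∀ xs → sumOver (λ _ → 0ℚ) xs ≡ 0ℚ
  sumOver-zero []       = refl
  sumOver-zero (x ∷ xs) = trans (ℚ.+-identityˡ _) (sumOver-zero xs)

  sumOver-filter : ∀ {P : Pred A 0ℓ} (P? : Decidable P) (g : A → ℚ) xs →
                   sumOver (λ x → if ⌊ P? x ⌋ then g x else 0ℚ) xs ≡ sumOver g (filter P? xs)
  sumOver-filter P? g []       = refl
  sumOver-filter P? g (x ∷ xs) with P? x
  ... | yes _ = cong (g x +_) (sumOver-filter P? g xs)
  ... | no _  = trans (ℚ.+-identityˡ _) (sumOver-filter P? g xs)

  sumOver-↭ : ∀ (g : A → ℚ) {xs ys} → map g xs ↭ map g ys → sumOver g xs ≡ sumOver g ys
  sumOver-↭ g {xs} {ys} gxs↭gys = begin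
    sumOver g xs             ≡⟨ foldr-map _+_ g 0ℚ xs ⟨
    foldr _+_ 0ℚ (map g xs)  ≡⟨ foldr-commMonoid ℚ.+-0-isCommutativeMonoid (↭⇒↭ₛ gxs↭gys) ⟩
    foldr _+_ 0ℚ (map g ys)  ≡⟨ foldr-map _+_ g 0ℚ ys ⟩
    sumOver g ys             ∎

sumOver-allFin-suc : ∀ {n} (g : Fin (suc n) → ℚ) →
                     sumOver g (allFin (suc n)) ≡ g zero + sumOver (g ∘ suc) (allFin n)
sumOver-allFin-suc {n} g = cong (g zero +_) (begin
  sumOver g (tabulate suc)        ≡⟨ cong (sumOver g) (map-tabulate id suc) ⟨
  sumOver g (map suc (allFin n))  ≡⟨ foldr-map _ suc 0ℚ (allFin n) ⟩
  sumOver (g ∘ suc) (allFin n)    ∎)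
  where open ≡-Reasoning

sumOver-δ : ∀ {n} (v : Fin n) (g : Fin n → ℚ) →
            sumOver (λ w → if ⌊ v ≟ w ⌋ then g w else 0ℚ) (allFin n) ≡ g v
sumOver-δ {suc n} zero g = begin
  sumOver δ (allFin (suc n))              ≡⟨ sumOver-allFin-suc δ ⟩
  g zero + sumOver (λ _ → 0ℚ) (allFin n)  ≡⟨ cong (g zero +_) (sumOver-zero (allFin n)) ⟩
  g zero + 0ℚ                             ≡⟨ ℚ.+-identityʳ (g zero) ⟩
  g zero                                  ∎
  where
  open ≡-Reasoning
  δ : Fin (suc n) → ℚ
  δ w = if ⌊ zero ≟ w ⌋ then g w else 0ℚ
sumOver-δ {suc n} (suc v) g = begin
  sumOver δ (allFin (suc n))                                       ≡⟨ sumOver-allFin-suc δ ⟩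
  0ℚ + sumOver (δ ∘ suc) (allFin n)                                ≡⟨ ℚ.+-identityˡ _ ⟩
  sumOver (δ ∘ suc) (allFin n)                                     ≡⟨ sumOver-cong δ-suc (allFin n) ⟩
  sumOver (λ w → if ⌊ v ≟ w ⌋ then g (suc w) else 0ℚ) (allFin n)  ≡⟨ sumOver-δ v (g ∘ suc) ⟩
  g (suc v)                                                        ∎
  where
  open ≡-Reasoning
  δ : Fin (suc n) → ℚ
  δ w = if ⌊ suc v ≟ w ⌋ then g w else 0ℚ
  δ-suc : ∀ w → δ (suc w) ≡ (if ⌊ v ≟ w ⌋ then g (suc w) else 0ℚ)
  δ-suc w = cong (if_then g (suc w) else 0ℚ) (⌊⌋-map′ _ _ (v ≟ w))

module _ {A : Set} where

  pigeonhole : ∀ {xs ys : List A} → Unique xs → xs ⊆ ys → length xs ≤ length ys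
  pigeonhole {[]}     _            _     = z≤n
  pigeonhole {x ∷ xs} (x∉xs ∷ !xs) xs⊆ys with as , bs , refl ← ∈-∃++ (xs⊆ys (here refl)) = begin
    suc (length xs)             ≤⟨ s≤s (pigeonhole !xs xs⊆as++bs) ⟩
    suc (length (as ++ bs))     ≡⟨ ↭-length (shift x as bs) ⟨
    length (as ++ [ x ] ++ bs)  ∎
    where
    open ≤-Reasoning
    xs⊆as++bs : xs ⊆ as ++ bs
    xs⊆as++bs y∈xs with ∈-resp-↭ (shift x as bs) (xs⊆ys (there y∈xs))
    ... | here y≡x = ⊥-elim (All.lookup x∉xs y∈xs (sym y≡x))
    ... | there y∈ = y∈

  length≡suc⇒∃∈ : ∀ {xs : List A} {n} → length xs ≡ suc n → ∃ (_∈ xs)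
  length≡suc⇒∃∈ {x ∷ _} _ = x , here refl

module _ {A B : Set} where

  map⁺-injectiveOn : ∀ {g : A → B} {xs} → (∀ {x y} → x ∈ xs → y ∈ xs → g x ≡ g y → x ≡ y) →
                     Unique xs → Unique (map g xs)
  map⁺-injectiveOn {xs = []}     _   []           = []
  map⁺-injectiveOn {xs = x ∷ xs} inj (x∉xs ∷ !xs) =
    Allₚ.map⁺ (All.tabulate λ y∈xs gx≡gy → All.lookup x∉xs y∈xs (inj (here refl) (there y∈xs) gx≡gy))
    ∷ map⁺-injectiveOn (λ x∈ y∈ → inj (there x∈) (there y∈)) !xs

module _ {A B : Set} {P : Pred B 0ℓ} (P? : Decidable P) where

  map-filter : ∀ (g : A → B) xs → map g (filter (P? ∘ g) xs) ≡ filter P? (map g xs)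
  map-filter g []       = refl
  map-filter g (x ∷ xs) with P? (g x)
  ... | yes _ = cong (g x ∷_) (map-filter g xs)
  ... | no _  = map-filter g xs

module _ {A : Set} where

  combinations : ℕ → List A → List (List A)
  combinations zero    xs       = [ [] ]
  combinations (suc k) []       = []
  combinations (suc k) (x ∷ xs) = map (x ∷_) (combinations k xs) ++ combinations (suc k) xs

  length-combinations : ∀ k xs → length (combinations k xs) ≡ length xs C k
  length-combinations zero    xs       = refl
  length-combinations (suc k) []       = refl
  length-combinations (suc k) (x ∷ xs) = begin
    length (map (x ∷_) (combinations k xs) ++ combinations (suc k) xs)
      ≡⟨ length-++ (map (x ∷_) (combinations k xs)) ⟩
    length (map (x ∷_) (combinations k xs)) +ℕ length (combinations (suc k) xs)
      ≡⟨ cong₂ _+ℕ_ (trans (length-map (x ∷_) (combinations k xs)) (length-combinations k xs))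
                    (length-combinations (suc k) xs) ⟩
    length xs C k +ℕ length xs C suc k
      ≡⟨ nCk+nC[k+1]≡[n+1]C[k+1] (length xs) k ⟩
    suc (length xs) C suc k
      ∎
    where open ≡-Reasoning

  sublist∈combinations : ∀ {ys xs} → ys Sublist.⊆ xs → ys ∈ combinations (length ys) xs
  sublist∈combinations {[]}     _              = here refl
  sublist∈combinations {_ ∷ _}  (_ ∷ʳ ys⊆xs)   = ∈-++⁺ʳ _ (sublist∈combinations ys⊆xs)
  sublist∈combinations {_ ∷ ys} (refl ∷ ys⊆xs) = ∈-++⁺ˡ (∈-map⁺ _ (sublist∈combinations ys⊆xs))

  module _ (_≟ᴬ_ : DecidableEquality A) where

    open import Data.List.Membership.DecPropositional _≟ᴬ_ using (_∈?_)

    -- A normal form of xs up to permutation, when xs ⊆ D and both lists are duplicate-free.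
    selectFrom : List A → List A → List A
    selectFrom D xs = filter (_∈? xs) D

    selectFrom-↭ : ∀ {D xs} → Unique D → Unique xs → xs ⊆ D → selectFrom D xs ↭ xs
    selectFrom-↭ {D} {xs} !D !xs xs⊆D = ∼bag⇒↭ (unique∧set⇒bag (Unique.filter⁺ (_∈? xs) !D) !xs
      (mk⇔ (proj₂ ∘ ∈-filter⁻ (_∈? xs) {xs = D}) (λ x∈xs → ∈-filter⁺ (_∈? xs) (xs⊆D x∈xs) x∈xs)))

    injectiveFamily-length≤C : ∀ {I : Set} {D : List A} {k} (X : I → List A) {is : List I} →
      Unique D → Unique is →
      (∀ {i} → i ∈ is → Unique (X i) × X i ⊆ D × length (X i) ≡ k) →
      (∀ {i j} → i ∈ is → j ∈ is → X i ↭ X j → i ≡ j) →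
      length is ≤ length D C k
    injectiveFamily-length≤C {I} {D} {k} X {is} !D !is X-kSubset X-injective = begin
      length is                  ≡⟨ length-map normal is ⟨
      length (map normal is)     ≤⟨ pigeonhole (map⁺-injectiveOn normal-injective !is) normal∈combinations ⟩
      length (combinations k D)  ≡⟨ length-combinations k D ⟩
      length D C k               ∎
      where
      open ≤-Reasoning
      normal : I → List A
      normal i = selectFrom D (X i)
      normal↭X : ∀ {i} → i ∈ is → normal i ↭ X i
      normal↭X i∈is with !Xi , Xi⊆D , _ ← X-kSubset i∈is = selectFrom-↭ !D !Xi Xi⊆D
      normal-injective : ∀ {i j} → i ∈ is → j ∈ is → normal i ≡ normal j → i ≡ j
      normal-injective {i} {j} i∈is j∈is nᵢ≡nⱼ =
        X-injective i∈is j∈is (↭-trans (↭-sym (normal↭X i∈is)) (subst (_↭ X j) (sym nᵢ≡nⱼ) (normal↭X j∈is)))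
      normal∈combinations : map normal is ⊆ combinations k D
      normal∈combinations x∈ with i , i∈is , refl ← ∈-map⁻ normal x∈ =
        subst (λ m → normal i ∈ combinations m D)
              (trans (↭-length (normal↭X i∈is)) (proj₂ (proj₂ (X-kSubset i∈is))))
              (sublist∈combinations (Sublistₚ.filter-⊆ _ D))

module _ {A : Set} (_≟ᴬ_ : DecidableEquality A) where

  count : A → List A → ℕ
  count x xs = length (filter (x ≟ᴬ_) xs)

  count-++ : ∀ x xs ys → count x (xs ++ ys) ≡ count x xs +ℕ count x ys
  count-++ x xs ys = trans (cong length (filter-++ (x ≟ᴬ_) xs ys)) (length-++ (filter (x ≟ᴬ_) xs))

  count-blocks : ∀ {t} (m : Fin t → ℕ) (label : Fin t → A) → (∀ {i j} → label i ≡ label j → i ≡ j) →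
                 ∀ i → count (label i) (concat (tabulate λ j → replicate (m j) (label j))) ≡ m i
  count-blocks {suc _} m label label-injective zero = begin
    count (label zero) (replicate (m zero) (label zero) ++ rest)
      ≡⟨ count-++ (label zero) (replicate (m zero) (label zero)) rest ⟩
    count (label zero) (replicate (m zero) (label zero)) +ℕ count (label zero) rest
      ≡⟨ cong₂ _+ℕ_ (cong length (filter-all (label zero ≟ᴬ_) (Allₚ.replicate⁺ (m zero) refl)))
                    (cong length (filter-none (label zero ≟ᴬ_) absent)) ⟩
    length (replicate (m zero) (label zero)) +ℕ 0
      ≡⟨ trans (+-identityʳ _) (length-replicate (m zero)) ⟩
    m zero
      ∎
    where
    open ≡-Reasoning
    rest : List A
    rest = concat (tabulate λ j → replicate (m (suc j)) (label (suc j)))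
    absent : All (λ x → label zero ≢ x) rest
    absent = Allₚ.concat⁺ (Allₚ.tabulate⁺ λ j → Allₚ.replicate⁺ (m (suc j)) ((λ ()) ∘ label-injective))
  count-blocks {suc _} m label label-injective (suc i) = begin
    count (label (suc i)) (replicate (m zero) (label zero) ++ rest)
      ≡⟨ count-++ (label (suc i)) (replicate (m zero) (label zero)) rest ⟩
    count (label (suc i)) (replicate (m zero) (label zero)) +ℕ count (label (suc i)) rest
      ≡⟨ cong (_+ℕ count (label (suc i)) rest) (cong length
           (filter-none (label (suc i) ≟ᴬ_) (Allₚ.replicate⁺ (m zero) ((λ ()) ∘ label-injective)))) ⟩
    count (label (suc i)) rest
      ≡⟨ count-blocks (m ∘ suc) (label ∘ suc) (suc-injective ∘ label-injective) i ⟩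
    m (suc i)
      ∎
    where
    open ≡-Reasoning
    rest : List A
    rest = concat (tabulate λ j → replicate (m (suc j)) (label (suc j)))

toList-tabulate : ∀ {A : Set} {n} (g : Fin n → A) → Vec.toList (Vec.tabulate g) ≡ tabulate g
toList-tabulate {n = zero}  g = refl
toList-tabulate {n = suc n} g = cong (g zero ∷_) (toList-tabulate (g ∘ suc))

map-lookup-allFin : ∀ {A : Set} {n} (v : Vec A n) → map (lookup v) (allFin n) ≡ Vec.toList v
map-lookup-allFin v = begin
  map (lookup v) (allFin _)             ≡⟨ map-tabulate id (lookup v) ⟩
  tabulate (lookup v)                   ≡⟨ toList-tabulate (lookup v) ⟨
  Vec.toList (Vec.tabulate (lookup v))  ≡⟨ cong Vec.toList (Vecₚ.tabulate∘lookup v) ⟩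
  Vec.toList v                          ∎
  where open ≡-Reasoning

partLabels-blocks : ∀ L q → Vec.toList (partLabels L q) ≡
                    concat (tabulate λ pos → replicate (List.lookup L pos) (q +ℕ toℕ pos))
partLabels-blocks []      q = refl
partLabels-blocks (s ∷ L) q = begin
  Vec.toList (Vec.replicate s q Vec.++ partLabels L (suc q))
    ≡⟨ Vecₚ.toList-++ (Vec.replicate s q) (partLabels L (suc q)) ⟩
  Vec.toList (Vec.replicate s q) ++ Vec.toList (partLabels L (suc q))
    ≡⟨ cong₂ _++_ (Vecₚ.toList-replicate s q) (partLabels-blocks L (suc q)) ⟩
  replicate s q ++ concat (tabulate λ pos → replicate (List.lookup L pos) (suc q +ℕ toℕ pos))
    ≡⟨ cong₂ _++_ (cong (replicate s) (sym (+-identityʳ q)))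
                  (cong concat (tabulate-cong λ pos →
                     cong (replicate (List.lookup L pos)) (sym (+-suc q (toℕ pos))))) ⟩
  replicate s (q +ℕ 0) ++ concat (tabulate λ pos → replicate (List.lookup L pos) (q +ℕ suc (toℕ pos)))
    ∎
  where open ≡-Reasoning

count-partSizes : ∀ {t} (ns : Vec ℕ t) i → count _≟ℕ_ (suc (toℕ i)) (partSizes ns) ≡ lookup ns i
count-partSizes ns i =
  trans (cong (count _≟ℕ_ (suc (toℕ i)) ∘ concat)
              (toList-tabulate λ j → replicate (lookup ns j) (suc (toℕ j))))
        (count-blocks _≟ℕ_ (lookup ns) (suc ∘ toℕ) (toℕ-injective ∘ ℕ.suc-injective) i)

module _ (G : Graph) where

  within-refl : ∀ v → T (within G 0 v v)
  within-refl v = fromWitness refl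

  within-extend : ∀ {m v u w} → T (within G m v u) → T (adj G u w) → T (within G (suc m) v w)
  within-extend {u = u} v⇝u u~w = T-∨ .from (inj₂ (any⁺ _ (tabulate⁺ u (T-∧ .from (v⇝u , u~w)))))

  adj⇒within₁ : ∀ {v w} → T (adj G v w) → T (within G 1 v w)
  adj⇒within₁ {v} = within-extend {m = 0} (within-refl v)

  within-suc⁻ : ∀ {m v w} → T (within G (suc m) v w) →
                T (within G m v w) ⊎ ∃ λ u → T (within G m v u) × T (adj G u w)
  within-suc⁻ h with T-∨ .to h
  ... | inj₁ v⇝w = inj₁ v⇝w
  ... | inj₂ h′  = inj₂ (Product.map₂ (T-∧ .to) (Any.satisfied (any⁻ _ (allFin (N G)) h′)))

  within₁⇒≡⊎adj : ∀ {v w} → T (within G 1 v w) → v ≡ w ⊎ T (adj G v w)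
  within₁⇒≡⊎adj {v} {w} h with within-suc⁻ {0} {v} {w} h
  ... | inj₁ v≡w = inj₁ (toWitness {a? = v ≟ w} v≡w)
  ... | inj₂ (u , v≡u , u~w) with refl ← toWitness {a? = v ≟ u} v≡u = inj₂ u~w

  within⇒≡⊎neighbour : ∀ m {v w} → T (within G m v w) → v ≡ w ⊎ ∃ λ z → T (adj G v z)
  within⇒≡⊎neighbour zero    {v} {w} h = inj₁ (toWitness {a? = v ≟ w} h)
  within⇒≡⊎neighbour (suc m) {v} {w} h with within-suc⁻ {m} {v} {w} h
  ... | inj₁ v⇝w = within⇒≡⊎neighbour m v⇝w
  ... | inj₂ (u , v⇝u , u~w) with within⇒≡⊎neighbour m {v} {u} v⇝u
  ...   | inj₁ refl = inj₂ (w , u~w)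
  ...   | inj₂ nb   = inj₂ nb

-- dist searches with fuel N G (returning its last candidate when the fuel runs out), so it
-- only unfolds once N G is a numeral; hence the splits on small N G.
dist≡0 : (G : Graph) {v w : Fin (N G)} → T (within G 0 v w) → dist G v w ≡ 0
dist≡0 G@record { N = suc _ } {v} {w} h with within G 0 v w
... | true = refl

dist≡1 : (G : Graph) {v w : Fin (N G)} → ¬ T (within G 0 v w) → T (within G 1 v w) → dist G v w ≡ 1
dist≡1 G@record { N = suc zero } {v} {w} h₀ _ with within G 0 v w
... | true  = ⊥-elim (h₀ _)
... | false = refl
dist≡1 G@record { N = suc (suc _) } {v} {w} h₀ _ with within G 0 v w | within G 1 v w
... | true  | _    = ⊥-elim (h₀ _)
... | false | true = refl

dist≡2 : (G : Graph) {v w : Fin (N G)} →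
         ¬ T (within G 0 v w) → ¬ T (within G 1 v w) → T (within G 2 v w) → dist G v w ≡ 2
dist≡2 G@record { N = suc zero } {zero} {zero} h₀ _ _ = ⊥-elim (h₀ _)
dist≡2 G@record { N = suc (suc zero) } {v} {w} h₀ h₁ _ with within G 0 v w | within G 1 v w
... | true  | _     = ⊥-elim (h₀ _)
... | false | true  = ⊥-elim (h₁ _)
... | false | false = refl
dist≡2 G@record { N = suc (suc (suc _)) } {v} {w} h₀ h₁ h₂
  with within G 0 v w | within G 1 v w | within G 2 v w
... | true  | _     | _    = ⊥-elim (h₀ _)
... | false | true  | _    = ⊥-elim (h₁ _)
... | false | false | true = refl

module CompleteMultipartite (L : List ℕ) where

  open ≡-Reasoning

  G : Graph
  G = completeMultipartite L

  V : Set
  V = Fin (sum L)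

  vertices : List V
  vertices = allFin (sum L)

  part : V → ℕ
  part = lookup (partLabels L 0)

  partVertices : ℕ → List V
  partVertices p = filter (λ w → p ≟ℕ part w) vertices

  ∈partVertices⇒≡ : ∀ {p w} → w ∈ partVertices p → p ≡ part w
  ∈partVertices⇒≡ {p} w∈ = proj₂ (∈-filter⁻ (λ w → p ≟ℕ part w) {xs = vertices} w∈)

  length-partVertices : ∀ pos → length (partVertices (toℕ pos)) ≡ List.lookup L pos
  length-partVertices pos = begin
    length (partVertices (toℕ pos))
      ≡⟨ length-map part (partVertices (toℕ pos)) ⟨
    length (map part (partVertices (toℕ pos)))
      ≡⟨ cong length (map-filter (toℕ pos ≟ℕ_) part vertices) ⟩
    count _≟ℕ_ (toℕ pos) (map part vertices)
      ≡⟨ cong (count _≟ℕ_ (toℕ pos)) (map-lookup-allFin (partLabels L 0)) ⟩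
    count _≟ℕ_ (toℕ pos) (Vec.toList (partLabels L 0))
      ≡⟨ cong (count _≟ℕ_ (toℕ pos)) (partLabels-blocks L 0) ⟩
    count _≟ℕ_ (toℕ pos) (concat (tabulate λ j → replicate (List.lookup L j) (toℕ j)))
      ≡⟨ count-blocks _≟ℕ_ (List.lookup L) toℕ toℕ-injective pos ⟩
    List.lookup L pos
      ∎

  partsOfSize : ℕ → List (Fin (length L))
  partsOfSize s = filter (λ pos → s ≟ℕ List.lookup L pos) (allFin (length L))

  ∈partsOfSize⇒≡ : ∀ {s pos} → pos ∈ partsOfSize s → s ≡ List.lookup L pos
  ∈partsOfSize⇒≡ {s} pos∈ = proj₂ (∈-filter⁻ (λ pos → s ≟ℕ List.lookup L pos) {xs = allFin _} pos∈)

  length-partsOfSize : ∀ s → length (partsOfSize s) ≡ count _≟ℕ_ s L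
  length-partsOfSize s = begin
    length (partsOfSize s)
      ≡⟨ length-map (List.lookup L) (partsOfSize s) ⟨
    length (map (List.lookup L) (partsOfSize s))
      ≡⟨ cong length (map-filter (s ≟ℕ_) (List.lookup L) (allFin _)) ⟩
    count _≟ℕ_ s (map (List.lookup L) (allFin (length L)))
      ≡⟨ cong (count _≟ℕ_ s) (map-tabulate id (List.lookup L)) ⟩
    count _≟ℕ_ s (tabulate (List.lookup L))
      ≡⟨ cong (count _≟ℕ_ s) (tabulate-lookup L) ⟩
    count _≟ℕ_ s L
      ∎

  cmDist : V → V → ℕ
  cmDist v w = if ⌊ v ≟ w ⌋ then 0 else if ⌊ part v ≟ℕ part w ⌋ then 2 else 1

  dist≡cmDist : Connected G → ∀ v w → dist G v w ≡ cmDist v w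
  dist≡cmDist conn v w with v ≟ w | part v ≟ℕ part w
  ... | yes refl | _       = dist≡0 G (within-refl G v)
  ... | no v≢w   | no v≁w  = dist≡1 G (v≢w ∘ toWitness) (adj⇒within₁ G (fromWitnessFalse v≁w))
  ... | no v≢w   | yes v∼w = dist≡2 G (v≢w ∘ toWitness) not-adjacent two-step
    where
    not-adjacent : ¬ T (within G 1 v w)
    not-adjacent h with within₁⇒≡⊎adj G h
    ... | inj₁ v≡w = v≢w v≡w
    ... | inj₂ v~w = toWitnessFalse v~w v∼w
    two-step : T (within G 2 v w)
    two-step with within⇒≡⊎neighbour G (N G) (T-≡ .from (conn v w))
    ... | inj₁ v≡w       = ⊥-elim (v≢w v≡w)
    ... | inj₂ (z , v~z) = within-extend G {m = 1} (adj⇒within₁ G v~z)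
                             (fromWitnessFalse λ z∼w → toWitnessFalse v~z (trans v∼w (sym z∼w)))

  module _ (f : V → ℚ) where

    partSum : ℕ → ℚ
    partSum p = sumOver f (partVertices p)

    inPart : ℕ → V → ℚ
    inPart p w = if ⌊ p ≟ℕ part w ⌋ then f w else 0ℚ

    coordinate : V → ℕ → ℚ
    coordinate v k = sumOver (λ w → if ⌊ dist G v w ≟ℕ k ⌋ then f w else 0ℚ) vertices

    atDistance : V → ℕ → V → ℚ
    atDistance v k w = if ⌊ cmDist v w ≟ℕ k ⌋ then f w else 0ℚ

    cmCoordinate : V → ℕ → ℚ
    cmCoordinate v k = sumOver (atDistance v k) vertices

    coordinate≡cmCoordinate : Connected G → ∀ v k → coordinate v k ≡ cmCoordinate v k
    coordinate≡cmCoordinate conn v k =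
      sumOver-cong (λ w → cong (λ d → if ⌊ d ≟ℕ k ⌋ then f w else 0ℚ) (dist≡cmDist conn v w)) vertices

    cmCoordinate₁ : ∀ v → cmCoordinate v 1 + partSum (part v) ≡ sumOver f vertices
    cmCoordinate₁ v = begin
      cmCoordinate v 1 + partSum (part v)
        ≡⟨ cong (cmCoordinate v 1 +_) (sumOver-filter _ f vertices) ⟨
      cmCoordinate v 1 + sumOver (inPart (part v)) vertices
        ≡⟨ sumOver-+ (atDistance v 1) (inPart (part v)) vertices ⟨
      sumOver (λ w → atDistance v 1 w + inPart (part v) w) vertices
        ≡⟨ sumOver-cong pointwise vertices ⟩
      sumOver f vertices
        ∎
      where
      pointwise : ∀ w → atDistance v 1 w + inPart (part v) w ≡ f w
      pointwise w with v ≟ w | part v ≟ℕ part w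
      ... | yes refl | yes _  = ℚ.+-identityˡ (f v)
      ... | yes refl | no v≁v = ⊥-elim (v≁v refl)
      ... | no _     | yes _  = ℚ.+-identityˡ (f w)
      ... | no _     | no _   = ℚ.+-identityʳ (f w)

    cmCoordinate₂ : ∀ v → cmCoordinate v 2 + f v ≡ partSum (part v)
    cmCoordinate₂ v = begin
      cmCoordinate v 2 + f v                                 ≡⟨ cong (cmCoordinate v 2 +_) (sumOver-δ v f) ⟨
      cmCoordinate v 2 + sumOver atV vertices                ≡⟨ sumOver-+ (atDistance v 2) atV vertices ⟨
      sumOver (λ w → atDistance v 2 w + atV w) vertices      ≡⟨ sumOver-cong pointwise vertices ⟩
      sumOver (inPart (part v)) vertices                     ≡⟨ sumOver-filter _ f vertices ⟩
      partSum (part v)                                       ∎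
      where
      atV : V → ℚ
      atV w = if ⌊ v ≟ w ⌋ then f w else 0ℚ
      pointwise : ∀ w → atDistance v 2 w + atV w ≡ inPart (part v) w
      pointwise w with v ≟ w | part v ≟ℕ part w
      ... | yes refl | yes _  = ℚ.+-identityˡ (f v)
      ... | yes refl | no v≁v = ⊥-elim (v≁v refl)
      ... | no _     | yes _  = ℚ.+-identityʳ (f w)
      ... | no _     | no _   = ℚ.+-identityˡ 0ℚ

    cmCoordinate₃₊ : ∀ v m → cmCoordinate v (suc (suc (suc m))) ≡ 0ℚ
    cmCoordinate₃₊ v m = trans (sumOver-cong pointwise vertices) (sumOver-zero vertices)
      where
      pointwise : ∀ w → atDistance v (suc (suc (suc m))) w ≡ 0ℚ
      pointwise w with v ≟ w | part v ≟ℕ part w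
      ... | yes _ | _     = refl
      ... | no _  | yes _ = refl
      ... | no _  | no _  = refl

    cmCoordinate-determined : ∀ {v w} → f v ≡ f w → partSum (part v) ≡ partSum (part w) →
                              ∀ k → cmCoordinate v (suc k) ≡ cmCoordinate w (suc k)
    cmCoordinate-determined {v} {w} _ Sv≡Sw zero = +-cancelʳ (partSum (part v)) _ _ (begin
      cmCoordinate v 1 + partSum (part v)  ≡⟨ cmCoordinate₁ v ⟩
      sumOver f vertices                   ≡⟨ cmCoordinate₁ w ⟨
      cmCoordinate w 1 + partSum (part w)  ≡⟨ cong (cmCoordinate w 1 +_) Sv≡Sw ⟨
      cmCoordinate w 1 + partSum (part v)  ∎)
    cmCoordinate-determined {v} {w} fv≡fw Sv≡Sw (suc zero) = +-cancelʳ (f v) _ _ (begin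
      cmCoordinate v 2 + f v  ≡⟨ cmCoordinate₂ v ⟩
      partSum (part v)        ≡⟨ Sv≡Sw ⟩
      partSum (part w)        ≡⟨ cmCoordinate₂ w ⟨
      cmCoordinate w 2 + f w  ≡⟨ cong (cmCoordinate w 2 +_) fv≡fw ⟨
      cmCoordinate w 2 + f v  ∎)
    cmCoordinate-determined {v} {w} _ _ (suc (suc m)) =
      trans (cmCoordinate₃₊ v m) (sym (cmCoordinate₃₊ w m))

    string-determined : Connected G → ∀ {v w} → f v ≡ f w → partSum (part v) ≡ partSum (part w) →
                        string G f v ≡ string G f w
    string-determined conn {v} {w} fv≡fw Sv≡Sw = Vecₚ.tabulate-cong λ j → begin
      coordinate v (suc (toℕ j))    ≡⟨ coordinate≡cmCoordinate conn v _ ⟩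
      cmCoordinate v (suc (toℕ j))  ≡⟨ cmCoordinate-determined fv≡fw Sv≡Sw (toℕ j) ⟩
      cmCoordinate w (suc (toℕ j))  ≡⟨ coordinate≡cmCoordinate conn w _ ⟨
      coordinate w (suc (toℕ j))    ∎

  module _ (conn : Connected G) {f : V → ℚ} (f-distinguishing : Distinguishing G f) where

    string-injective : ∀ {v w} → string G f v ≡ string G f w → v ≡ w
    string-injective {v} {w} eq = decidable-stable (v ≟ w) λ v≢w → f-distinguishing v w v≢w eq

    partValues : ℕ → List ℚ
    partValues p = map f (partVertices p)

    partValues-unique : ∀ p → Unique (partValues p)
    partValues-unique p = map⁺-injectiveOn injective (Unique.filter⁺ _ (Unique.allFin⁺ (sum L)))
      where
      injective : ∀ {u w} → u ∈ partVertices p → w ∈ partVertices p → f u ≡ f w → u ≡ w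
      injective u∈ w∈ fu≡fw = string-injective (string-determined f conn fu≡fw
        (cong (partSum f) (trans (sym (∈partVertices⇒≡ u∈)) (∈partVertices⇒≡ w∈))))

    partValues-↭⇒≡ : ∀ {p q x} → x ∈ partValues p → partValues p ↭ partValues q → p ≡ q
    partValues-↭⇒≡ {p} {q} x∈ p↭q
      with v , v∈ , refl ← ∈-map⁻ f x∈
      with w , w∈ , fv≡fw ← ∈-map⁻ f (∈-resp-↭ p↭q x∈) = begin
      p       ≡⟨ ∈partVertices⇒≡ v∈ ⟩
      part v  ≡⟨ cong part (string-injective (string-determined f conn fv≡fw Sv≡Sw)) ⟩
      part w  ≡⟨ ∈partVertices⇒≡ w∈ ⟨
      q       ∎
      where
      Sv≡Sw : partSum f (part v) ≡ partSum f (part w)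
      Sv≡Sw = begin
        partSum f (part v)  ≡⟨ cong (partSum f) (∈partVertices⇒≡ v∈) ⟨
        partSum f p         ≡⟨ sumOver-↭ f p↭q ⟩
        partSum f q         ≡⟨ cong (partSum f) (∈partVertices⇒≡ w∈) ⟩
        partSum f (part w)  ∎

    image : List ℚ
    image = deduplicate _≟ℚ_ (map f vertices)

    partValues⊆image : ∀ p → partValues p ⊆ image
    partValues⊆image p x∈ with v , _ , refl ← ∈-map⁻ f x∈ = ∈-deduplicate⁺ _≟ℚ_ (∈-map⁺ f (∈-allFin v))

    length-partsOfSize≤C : ∀ s → length (partsOfSize (suc s)) ≤ imageSize G f C suc s
    length-partsOfSize≤C s = injectiveFamily-length≤C _≟ℚ_ (partValues ∘ toℕ)
      (deduplicate-! _≟ℚ_ (map f vertices)) (Unique.filter⁺ _ (Unique.allFin⁺ (length L))) family injective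
      where
      length-partValues : ∀ {pos} → pos ∈ partsOfSize (suc s) → length (partValues (toℕ pos)) ≡ suc s
      length-partValues {pos} pos∈ = begin
        length (partValues (toℕ pos))    ≡⟨ length-map f (partVertices (toℕ pos)) ⟩
        length (partVertices (toℕ pos))  ≡⟨ length-partVertices pos ⟩
        List.lookup L pos                ≡⟨ ∈partsOfSize⇒≡ pos∈ ⟨
        suc s                            ∎
      family : ∀ {pos} → pos ∈ partsOfSize (suc s) →
               Unique (partValues (toℕ pos)) × partValues (toℕ pos) ⊆ image ×
               length (partValues (toℕ pos)) ≡ suc s
      family pos∈ = partValues-unique _ , partValues⊆image _ , length-partValues pos∈
      injective : ∀ {pos pos′} → pos ∈ partsOfSize (suc s) → pos′ ∈ partsOfSize (suc s) →
                  partValues (toℕ pos) ↭ partValues (toℕ pos′) → pos ≡ pos′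
      injective pos∈ _ ↭ with x , x∈ ← length≡suc⇒∃∈ (length-partValues pos∈) =
        toℕ-injective (partValues-↭⇒≡ x∈ ↭)

proposition8 : (t : ℕ) (ns : Vec ℕ t) → Connected (K ns) →
    (k : ℕ) → IsIDI (K ns) k →
    (i : Fin t) → lookup ns i ≤ k C suc (toℕ i)
proposition8 _ ns conn k ((f , f-distinguishing , |f|≡k) , _) i = begin
  lookup ns i                                     ≡⟨ count-partSizes ns i ⟨
  count _≟ℕ_ (suc (toℕ i)) (partSizes ns)         ≡⟨ length-partsOfSize (suc (toℕ i)) ⟨
  length (partsOfSize (suc (toℕ i)))              ≤⟨ length-partsOfSize≤C conn f-distinguishing (toℕ i) ⟩
  imageSize (K ns) f C suc (toℕ i)                ≡⟨ cong (_C suc (toℕ i)) |f|≡k ⟩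
  k C suc (toℕ i)                                 ∎
  where
  open ≤-Reasoning
  open CompleteMultipartite (partSizes ns)
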